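{- Let $n\ge1$ be an integer not divisible by $3$. Then $C_{3,n}(q,t)=C_{3,n}(t,q)$.
   Context: A $(3,n)$-Dyck path is a lattice path from $(0,0)$ to $(3,n)$ using unit north and east steps that stays weakly above the line $y=\frac{n}{3}x$. The cell $(a,b)$ ($a\in\{1,2,3\}$ column, $b\in\{1,\dots,n\}$ row) is $[a-1,a]\times[b-1,b]$. For a path $\Pi$, $\lambda(\Pi)$ is the set of cells lying above (north-west of) $\Pi$. $\operatorname{area}(\Pi)$ is the number of cells lying entirely below $\Pi$ and above the line $y=\frac n3x$. For $x\in\lambda(\Pi)$, $\operatorname{arm}(x)$ (resp. $\operatorname{leg}(x)$) is the number of cells of $\lambda(\Pi)$ strictly east (resp. strictly south) of $x$ in its row (resp. column). $\operatorname{dinv}(\Pi)$ is the number of $x\in\lambda(\Pi)$ with $\frac{\operatorname{arm}(x)}{\operatorname{leg}(x)+1}<\frac{3}{n}<\frac{\operatorname{arm}(x)+1}{\operatorname{leg}(x)}$ (right side $+\infty$ if $\operatorname{leg}(x)=0$). $C_{3,n}(q,t)=\sum_{\Pi}q^{\operatorname{dinv}(\Pi)}t^{\operatorname{area}(\Pi)}$ over all $(3,n)$-Dyck paths. -}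

module Defs where

open import Data.Bool using (Bool; true; false; _∧_; _∨_; not; if_then_else_)
open import Data.Nat using (ℕ; zero; suc; _+_; _*_; _∸_; _≡ᵇ_; _<ᵇ_; _≤ᵇ_)
open import Data.Product using (_×_; _,_; proj₁; proj₂)
open import Data.List using (List; []; _∷_; length; map; concatMap; filterᵇ; upTo; inits)
open import Data.Bool.ListAction using (and)

data Step : Set where
  N E : Step

words : ℕ → List (List Step)
words zero    = [] ∷ []
words (suc k) = concatMap (λ w → (N ∷ w) ∷ (E ∷ w) ∷ []) (words k)

countE countN : List Step → ℕ
countE []      = 0
countE (N ∷ w) = countE w
countE (E ∷ w) = suc (countE w)
countN []      = 0
countN (N ∷ w) = suc (countN w)
countN (E ∷ w) = countN w

-- A word w is a (3,n)-Dyck path: 3 east steps, n north steps, and every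
-- lattice point (x,y) visited (= endpoint of a prefix) satisfies y ≥ (n/3) x,
-- i.e. n*x ≤ 3*y.
isDyck : ℕ → List Step → Bool
isDyck n w = (countE w ≡ᵇ 3) ∧ (countN w ≡ᵇ n)
             ∧ and (map (λ p → (n * countE p) ≤ᵇ (3 * countN p)) (inits w))

paths : ℕ → List (List Step)
paths n = filterᵇ (isDyck n) (words (n + 3))

-- height w a = number of north steps before the a-th east step (a ≥ 1),
-- i.e. the y-coordinate at which the path crosses column a.
height : List Step → ℕ → ℕ
height []      _             = 0
height (N ∷ w) a             = suc (height w a)
height (E ∷ w) zero          = 0
height (E ∷ w) (suc zero)    = 0
height (E ∷ w) (suc (suc a)) = height w (suc a)

oneTo : ℕ → List ℕ
oneTo k = map suc (upTo k)

countᵇ : {A : Set} → (A → Bool) → List A → ℕ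
countᵇ p xs = length (filterᵇ p xs)

-- cell (a,b) = [a-1,a]×[b-1,b] lies above (north-west of) the path
inLambda : List Step → ℕ → ℕ → Bool
inLambda w a b = height w a <ᵇ b

cells : ℕ → List (ℕ × ℕ)
cells n = concatMap (λ a → map (λ b → a , b) (oneTo n)) (oneTo 3)

-- area: cells lying entirely below the path (b ≤ height) and entirely above
-- the line y = (n/3) x (lowest-right corner (a, b-1) satisfies n*a ≤ 3*(b-1)).
area : ℕ → List Step → ℕ
area n w = countᵇ (λ c → (proj₂ c ≤ᵇ height w (proj₁ c))
                         ∧ ((n * proj₁ c) ≤ᵇ (3 * (proj₂ c ∸ 1)))) (cells n)

arm : ℕ → List Step → ℕ → ℕ → ℕ
arm n w a b = countᵇ (λ a' → (a <ᵇ a') ∧ inLambda w a' b) (oneTo 3)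

leg : ℕ → List Step → ℕ → ℕ → ℕ
leg n w a b = countᵇ (λ b' → (b' <ᵇ b) ∧ inLambda w a b') (oneTo n)

-- arm/(leg+1) < 3/n < (arm+1)/leg  (right side +∞ when leg = 0),
-- cross-multiplied (all denominators positive, n ≥ 1).
dinvCond : ℕ → ℕ → ℕ → Bool
dinvCond n ar lg = ((ar * n) <ᵇ (3 * (lg + 1)))
                   ∧ ((lg ≡ᵇ 0) ∨ ((3 * lg) <ᵇ ((ar + 1) * n)))

dinv : ℕ → List Step → ℕ
dinv n w = countᵇ (λ c → inLambda w (proj₁ c) (proj₂ c)
                         ∧ dinvCond n (arm n w (proj₁ c) (proj₂ c))
                                      (leg n w (proj₁ c) (proj₂ c))) (cells n)

-- Coefficient of q^i t^j in C_{3,n}(q,t) = Σ_Π q^{dinv Π} t^{area Π}.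
coeffC : ℕ → ℕ → ℕ → ℕ
coeffC n i j = countᵇ (λ p → (dinv n p ≡ᵇ i) ∧ (area n p ≡ᵇ j)) (paths n)

-- Write n = 3m + 1 + e with e ∈ {0, 1}. A (3,n)-Dyck path is N^a E N^b E N^c E with a + b + c = n,
-- and the line conditions at its corners become a ≥ m + 1 and a + b ≥ 2m + 1 + e. Counting cells
-- column by column gives area = (a − m − 1) + (a + b − 2m − 1 − e) and
-- dinv = min(b, m + 1) + (c − (m − b)) + min(c, m + 1) (truncated subtraction), because a cell of λ in
-- column 1 or 2 has arm 0 or 1 and then satisfies the dinv condition exactly when its leg is at most m,
-- resp. at least m. Splitting the paths according to b + c ≤ m, b ≤ m < b + c or m < b, the map
-- path ↦ (dinv, area) is injective, the three families being told apart by dinv − m (at most 0,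
-- positive and even, odd), and its image is {(i, j) : i + j ≤ n − 1 ≤ min(2i + j, i + 2j)}.
-- So every coefficient of C_{3,n} is 0 or 1, and the support is symmetric in (i, j).

module Submission where

open import Defs
open import Data.Bool.Base using (Bool; true; false; _∧_; _∨_; T; if_then_else_)
open import Data.Bool.ListAction using (and)
open import Data.Bool.Properties using (∧-identityʳ; ∧-assoc; ∧-zeroʳ; ∨-zeroʳ)
open import Data.Empty using (⊥; ⊥-elim)
open import Data.List.Base using (List; []; _∷_; _++_; map; length; filterᵇ; applyUpTo; concatMap; inits; replicate)
open import Data.List.Properties using (map-upTo; map-∘; map-cong; length-replicate; length-++; ∷-injectiveʳ)
open import Data.Nat.Base
open import Data.Nat.Properties
open import Data.Nat.DivMod using (_%_; _/_; m≡m%n+[m/n]*n; m%n<n)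
open import Data.Nat.Divisibility using (_∣_; m%n≡0⇒n∣m)
open import Data.Nat.Tactic.RingSolver using (solve-∀; solve)
open import Data.Product.Base using (Σ-syntax; _×_; _,_; proj₁; proj₂)
open import Data.Sum.Base using (inj₁; inj₂)
open import Function.Base using (_∘_)
open import Relation.Nullary using (¬_; yes; no)
open import Relation.Nullary.Decidable.Core using (Dec; _×-dec_)
open import Relation.Binary.PropositionalEquality

≡true⇒T : ∀ {b} → b ≡ true → T b
≡true⇒T refl = _

T⇒≡true : ∀ {b} → T b → b ≡ true
T⇒≡true {true} _ = refl

≤ᵇ-true : ∀ {m n} → m ≤ n → (m ≤ᵇ n) ≡ true
≤ᵇ-true = T⇒≡true ∘ ≤⇒≤ᵇ

<ᵇ-true : ∀ {m n} → m < n → (m <ᵇ n) ≡ true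
<ᵇ-true = T⇒≡true ∘ <⇒<ᵇ

≡ᵇ-true : ∀ {m n} → m ≡ n → (m ≡ᵇ n) ≡ true
≡ᵇ-true {m} {n} = T⇒≡true ∘ ≡⇒≡ᵇ m n

≤ᵇ-sound : ∀ {m n} → (m ≤ᵇ n) ≡ true → m ≤ n
≤ᵇ-sound {m} {n} = ≤ᵇ⇒≤ m n ∘ ≡true⇒T

<ᵇ-sound : ∀ {m n} → (m <ᵇ n) ≡ true → m < n
<ᵇ-sound {m} {n} = <ᵇ⇒< m n ∘ ≡true⇒T

≡ᵇ-sound : ∀ {m n} → (m ≡ᵇ n) ≡ true → m ≡ n
≡ᵇ-sound {m} {n} = ≡ᵇ⇒≡ m n ∘ ≡true⇒T

≤ᵇ-false : ∀ {m n} → n < m → (m ≤ᵇ n) ≡ false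
≤ᵇ-false {m} {n} n<m with m ≤ᵇ n in eq
... | false = refl
... | true  = ⊥-elim (<⇒≱ n<m (≤ᵇ-sound eq))

<ᵇ-false : ∀ {m n} → n ≤ m → (m <ᵇ n) ≡ false
<ᵇ-false {m} {n} n≤m with m <ᵇ n in eq
... | false = refl
... | true  = ⊥-elim (<⇒≱ (<ᵇ-sound eq) n≤m)

∧-true⁻ : ∀ a {b} → a ∧ b ≡ true → a ≡ true × b ≡ true
∧-true⁻ true eq = refl , eq

∧-true⁺ : ∀ {a b} → a ≡ true → b ≡ true → a ∧ b ≡ true
∧-true⁺ refl refl = refl

countᵇ-++ : ∀ {A : Set} (p : A → Bool) (xs ys : List A) → countᵇ p (xs ++ ys) ≡ countᵇ p xs + countᵇ p ys
countᵇ-++ p []       ys = refl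
countᵇ-++ p (x ∷ xs) ys with p x
... | true  = cong suc (countᵇ-++ p xs ys)
... | false = countᵇ-++ p xs ys

countᵇ-map : ∀ {A B : Set} (p : B → Bool) (f : A → B) (xs : List A) → countᵇ p (map f xs) ≡ countᵇ (p ∘ f) xs
countᵇ-map p f []       = refl
countᵇ-map p f (x ∷ xs) with p (f x)
... | true  = cong suc (countᵇ-map p f xs)
... | false = countᵇ-map p f xs

countᵇ-filterᵇ : ∀ {A : Set} (p q : A → Bool) (xs : List A) → countᵇ p (filterᵇ q xs) ≡ countᵇ (λ x → q x ∧ p x) xs
countᵇ-filterᵇ p q []       = refl
countᵇ-filterᵇ p q (x ∷ xs) with q x
... | false = countᵇ-filterᵇ p q xs
... | true with p x
...   | true  = cong suc (countᵇ-filterᵇ p q xs)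
...   | false = countᵇ-filterᵇ p q xs

countᵇ-none : ∀ {A : Set} (p : A → Bool) (xs : List A) → (∀ x → p x ≡ false) → countᵇ p xs ≡ 0
countᵇ-none p []       never = refl
countᵇ-none p (x ∷ xs) never rewrite never x = countᵇ-none p xs never

countBelow : (ℕ → Bool) → ℕ → ℕ
countBelow f zero    = 0
countBelow f (suc n) = if f 0 then suc (countBelow (f ∘ suc) n) else countBelow (f ∘ suc) n

countᵇ-applyUpTo : (p : ℕ → Bool) (g : ℕ → ℕ) (n : ℕ) → countᵇ p (applyUpTo g n) ≡ countBelow (p ∘ g) n
countᵇ-applyUpTo p g zero    = refl
countᵇ-applyUpTo p g (suc n) with p (g 0)
... | true  = cong suc (countᵇ-applyUpTo p (g ∘ suc) n)
... | false = countᵇ-applyUpTo p (g ∘ suc) n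

countᵇ-oneTo : (p : ℕ → Bool) (n : ℕ) → countᵇ p (oneTo n) ≡ countBelow (p ∘ suc) n
countᵇ-oneTo p n = trans (cong (countᵇ p) (map-upTo suc n)) (countᵇ-applyUpTo p suc n)

countBelow-cong : ∀ {f g} n → (∀ k → k < n → f k ≡ g k) → countBelow f n ≡ countBelow g n
countBelow-cong zero    f≗g = refl
countBelow-cong {f} {g} (suc n) f≗g rewrite f≗g 0 z<s =
  cong (λ c → if g 0 then suc c else c) (countBelow-cong n (λ k k<n → f≗g (suc k) (s<s k<n)))

countBelow-+ : ∀ f m n → countBelow f (m + n) ≡ countBelow f m + countBelow (λ k → f (m + k)) n
countBelow-+ f zero    n = refl
countBelow-+ f (suc m) n with f 0
... | true  = cong suc (countBelow-+ (f ∘ suc) m n)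
... | false = countBelow-+ (f ∘ suc) m n

countBelow-false : ∀ {f} n → (∀ k → k < n → f k ≡ false) → countBelow f n ≡ 0
countBelow-false zero    never = refl
countBelow-false (suc n) never rewrite never 0 z<s = countBelow-false n (λ k k<n → never (suc k) (s<s k<n))

countBelow-true : ∀ {f} n → (∀ k → k < n → f k ≡ true) → countBelow f n ≡ n
countBelow-true zero    always = refl
countBelow-true (suc n) always rewrite always 0 z<s = cong suc (countBelow-true n (λ k k<n → always (suc k) (s<s k<n)))

countBelow-block : ∀ {f} h l r → (∀ k → k < h → f k ≡ false) → (∀ k → k < l → f (h + k) ≡ true)
  → (∀ k → k < r → f (h + (l + k)) ≡ false) → countBelow f (h + (l + r)) ≡ l
countBelow-block {f} h l r below inside above = begin
  countBelow f (h + (l + r))                                                  ≡⟨ countBelow-+ f h (l + r) ⟩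
  countBelow f h + countBelow (λ k → f (h + k)) (l + r)                       ≡⟨ cong₂ _+_ (countBelow-false h below) (countBelow-+ _ l r) ⟩
  countBelow (λ k → f (h + k)) l + countBelow (λ k → f (h + (l + k))) r       ≡⟨ cong₂ _+_ (countBelow-true l inside) (countBelow-false r above) ⟩
  l + 0                                                                        ≡⟨ +-identityʳ l ⟩
  l                                                                            ∎
  where open ≡-Reasoning

<ᵇ-suc : ∀ t k → (t <ᵇ suc k) ≡ (t ≤ᵇ k)
<ᵇ-suc zero    k = refl
<ᵇ-suc (suc t) k = refl

countBelow-<ᵇ : ∀ t n → countBelow (_<ᵇ t) n ≡ n ⊓ t
countBelow-<ᵇ zero    n       = trans (countBelow-false n (λ _ _ → refl)) (sym (⊓-zeroʳ n))
countBelow-<ᵇ (suc t) zero    = refl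
countBelow-<ᵇ (suc t) (suc n) = cong suc (countBelow-<ᵇ t n)

countBelow-≤ᵇ : ∀ t n → countBelow (t ≤ᵇ_) n ≡ n ∸ t
countBelow-≤ᵇ zero    n       = countBelow-true n (λ _ _ → refl)
countBelow-≤ᵇ (suc t) zero    = refl
countBelow-≤ᵇ (suc t) (suc n) = trans (countBelow-cong n (λ k _ → <ᵇ-suc t k)) (countBelow-≤ᵇ t n)

Bool-ext : ∀ {p q : Bool} → (p ≡ true → q ≡ true) → (q ≡ true → p ≡ true) → p ≡ q
Bool-ext {true}  {q}     p⇒q _   = sym (p⇒q refl)
Bool-ext {false} {true}  _   q⇒p = q⇒p refl
Bool-ext {false} {false} _   _   = refl

≤ᵇ-cong : ∀ {a b c d} → (a ≤ b → c ≤ d) → (c ≤ d → a ≤ b) → (a ≤ᵇ b) ≡ (c ≤ᵇ d)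
≤ᵇ-cong to from = Bool-ext (≤ᵇ-true ∘ to ∘ ≤ᵇ-sound) (≤ᵇ-true ∘ from ∘ ≤ᵇ-sound)

≤-witness : ∀ {m n} k → m + k ≡ n → m ≤ n
≤-witness {m} k refl = m≤m+n m k

-- Words and Dyck paths with three east steps

countᵇ-words : (p : List Step → Bool) (k : ℕ) →
  countᵇ p (words (suc k)) ≡ countᵇ (p ∘ (N ∷_)) (words k) + countᵇ (p ∘ (E ∷_)) (words k)
countᵇ-words p k = go (words k)
  where
  go : (ws : List (List Step)) →
    countᵇ p (concatMap (λ w → (N ∷ w) ∷ (E ∷ w) ∷ []) ws) ≡ countᵇ (p ∘ (N ∷_)) ws + countᵇ (p ∘ (E ∷_)) ws
  go []       = refl
  go (w ∷ ws) with p (N ∷ w)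
  ... | true with p (E ∷ w)
  ...   | true  = cong suc (trans (cong suc (go ws)) (sym (+-suc _ _)))
  ...   | false = cong suc (go ws)
  go (w ∷ ws) | false with p (E ∷ w)
  ...   | true  = trans (cong suc (go ws)) (sym (+-suc _ _))
  ...   | false = go ws

unique⇒false : ∀ {A : Set} (p : A → Bool) {x₀} → (∀ x → p x ≡ true → x ≡ x₀) → ∀ x → x ≢ x₀ → p x ≡ false
unique⇒false p unique x x≢x₀ with p x in px
... | false = refl
... | true  = ⊥-elim (x≢x₀ (unique x px))

countᵇ-words-unique : (p : List Step → Bool) (w₀ : List Step) → p w₀ ≡ true →
  (∀ w → p w ≡ true → w ≡ w₀) → countᵇ p (words (length w₀)) ≡ 1
countᵇ-words-unique p []       pw₀ unique rewrite pw₀ = refl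
countᵇ-words-unique p (N ∷ w₀) pw₀ unique = trans (countᵇ-words p (length w₀)) (cong₂ _+_
  (countᵇ-words-unique (p ∘ (N ∷_)) w₀ pw₀ (λ w → ∷-injectiveʳ ∘ unique (N ∷ w)))
  (countᵇ-none _ (words (length w₀)) (λ w → unique⇒false p unique (E ∷ w) (λ ()))))
countᵇ-words-unique p (E ∷ w₀) pw₀ unique = trans (countᵇ-words p (length w₀)) (cong₂ _+_
  (countᵇ-none _ (words (length w₀)) (λ w → unique⇒false p unique (N ∷ w) (λ ())))
  (countᵇ-words-unique (p ∘ (E ∷_)) w₀ pw₀ (λ w → ∷-injectiveʳ ∘ unique (E ∷ w))))

Ns : ℕ → List Step
Ns a = replicate a N

path : ℕ → ℕ → ℕ → List Step
path a b c = Ns a ++ E ∷ Ns b ++ E ∷ Ns c ++ E ∷ []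

aboveᵇ : ℕ → ℕ → ℕ → Bool
aboveᵇ n x y = n * x ≤ᵇ 3 * y

aboveᵇ-mono : ∀ n x {y y′} → y ≤ y′ → aboveᵇ n x y ≡ true → aboveᵇ n x y′ ≡ true
aboveᵇ-mono n x y≤y′ h = ≤ᵇ-true {n * x} (≤-trans (≤ᵇ-sound h) (*-monoʳ-≤ 3 y≤y′))

pathAbove : ℕ → ℕ → ℕ → List Step → Bool
pathAbove n x y []      = aboveᵇ n x y
pathAbove n x y (N ∷ w) = aboveᵇ n x y ∧ pathAbove n x (suc y) w
pathAbove n x y (E ∷ w) = aboveᵇ n x y ∧ pathAbove n (suc x) y w

prefixesAbove≡pathAbove : ∀ n x y w →
  and (map (λ p → n * (countE p + x) ≤ᵇ 3 * (countN p + y)) (inits w)) ≡ pathAbove n x y w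
prefixesAbove≡pathAbove n x y []      = ∧-identityʳ _
prefixesAbove≡pathAbove n x y (N ∷ w) = cong (aboveᵇ n x y ∧_) (begin
  and (map _ (map (N ∷_) (inits w)))
    ≡⟨ cong and (sym (map-∘ (inits w))) ⟩
  and (map (λ p → n * (countE (N ∷ p) + x) ≤ᵇ 3 * (countN (N ∷ p) + y)) (inits w))
    ≡⟨ cong and (map-cong (λ p → cong (λ z → n * (countE p + x) ≤ᵇ 3 * z) (sym (+-suc (countN p) y))) (inits w)) ⟩
  and (map (λ p → n * (countE p + x) ≤ᵇ 3 * (countN p + suc y)) (inits w))
    ≡⟨ prefixesAbove≡pathAbove n x (suc y) w ⟩
  pathAbove n x (suc y) w ∎)
  where open ≡-Reasoning
prefixesAbove≡pathAbove n x y (E ∷ w) = cong (aboveᵇ n x y ∧_) (begin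
  and (map _ (map (E ∷_) (inits w)))
    ≡⟨ cong and (sym (map-∘ (inits w))) ⟩
  and (map (λ p → n * (countE (E ∷ p) + x) ≤ᵇ 3 * (countN (E ∷ p) + y)) (inits w))
    ≡⟨ cong and (map-cong (λ p → cong (λ z → n * z ≤ᵇ 3 * (countN p + y)) (sym (+-suc (countE p) x))) (inits w)) ⟩
  and (map (λ p → n * (countE p + suc x) ≤ᵇ 3 * (countN p + y)) (inits w))
    ≡⟨ prefixesAbove≡pathAbove n (suc x) y w ⟩
  pathAbove n (suc x) y w ∎)
  where open ≡-Reasoning

isDyck≡pathAbove : ∀ n w → isDyck n w ≡ ((countE w ≡ᵇ 3) ∧ (countN w ≡ᵇ n)) ∧ pathAbove n 0 0 w
isDyck≡pathAbove n w = trans (cong (λ b → (countE w ≡ᵇ 3) ∧ (countN w ≡ᵇ n) ∧ b) (trans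
  (cong and (map-cong (λ p → cong₂ (λ x y → n * x ≤ᵇ 3 * y) (sym (+-identityʳ (countE p))) (sym (+-identityʳ (countN p)))) (inits w)))
  (prefixesAbove≡pathAbove n 0 0 w)))
  (sym (∧-assoc (countE w ≡ᵇ 3) (countN w ≡ᵇ n) _))

pathAbove-head : ∀ n x y w → pathAbove n x y w ≡ true → aboveᵇ n x y ≡ true
pathAbove-head n x y []      h = h
pathAbove-head n x y (N ∷ w) h = proj₁ (∧-true⁻ _ h)
pathAbove-head n x y (E ∷ w) h = proj₁ (∧-true⁻ _ h)

pathAbove-corner : ∀ n x y a w → pathAbove n x y (Ns a ++ E ∷ w) ≡ aboveᵇ n x y ∧ pathAbove n (suc x) (y + a) w
pathAbove-corner n x y zero    w rewrite +-identityʳ y with aboveᵇ n x y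
... | true  = refl
... | false = refl
pathAbove-corner n x y (suc a) w with aboveᵇ n x y in h
... | false = refl
... | true  = begin
  pathAbove n x (suc y) (Ns a ++ E ∷ w)           ≡⟨ pathAbove-corner n x (suc y) a w ⟩
  aboveᵇ n x (suc y) ∧ pathAbove n (suc x) (suc y + a) w
    ≡⟨ cong₂ _∧_ (aboveᵇ-mono n x (n≤1+n y) h) (cong (λ z → pathAbove n (suc x) z w) (sym (+-suc y a))) ⟩
  pathAbove n (suc x) (y + suc a) w ∎
  where open ≡-Reasoning

countE-Ns : ∀ a w → countE (Ns a ++ w) ≡ countE w
countE-Ns zero    w = refl
countE-Ns (suc a) w = countE-Ns a w

countN-Ns : ∀ a w → countN (Ns a ++ w) ≡ a + countN w
countN-Ns zero    w = refl
countN-Ns (suc a) w = cong suc (countN-Ns a w)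

split-at-E : ∀ w k → countE w ≡ suc k → Σ[ a ∈ ℕ ] Σ[ w′ ∈ List Step ] w ≡ Ns a ++ E ∷ w′ × countE w′ ≡ k
split-at-E (N ∷ w) k eq with split-at-E w k eq
... | a , w′ , refl , eq′ = suc a , w′ , refl , eq′
split-at-E (E ∷ w) k eq = 0 , w , refl , suc-injective eq

countE≡0⇒Ns : ∀ w → countE w ≡ 0 → w ≡ Ns (countN w)
countE≡0⇒Ns []      _  = refl
countE≡0⇒Ns (N ∷ w) eq = cong (N ∷_) (countE≡0⇒Ns w eq)

record DyckTriple (n : ℕ) : Set where
  constructor triple
  field
    a b c   : ℕ
    total   : a + (b + c) ≡ n
    column₁ : n * 1 ≤ 3 * a
    column₂ : n * 2 ≤ 3 * (a + b)

pathAbove-corners : ∀ n a b c w → pathAbove n 0 0 (Ns a ++ E ∷ Ns b ++ E ∷ Ns c ++ E ∷ w)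
  ≡ aboveᵇ n 0 0 ∧ (aboveᵇ n 1 a ∧ (aboveᵇ n 2 (a + b) ∧ pathAbove n 3 (a + b + c) w))
pathAbove-corners n a b c w = begin
  pathAbove n 0 0 (Ns a ++ E ∷ Ns b ++ E ∷ Ns c ++ E ∷ w)
    ≡⟨ pathAbove-corner n 0 0 a _ ⟩
  aboveᵇ n 0 0 ∧ pathAbove n 1 a (Ns b ++ E ∷ Ns c ++ E ∷ w)
    ≡⟨ cong (aboveᵇ n 0 0 ∧_) (pathAbove-corner n 1 a b _) ⟩
  aboveᵇ n 0 0 ∧ (aboveᵇ n 1 a ∧ pathAbove n 2 (a + b) (Ns c ++ E ∷ w))
    ≡⟨ cong (λ r → aboveᵇ n 0 0 ∧ (aboveᵇ n 1 a ∧ r)) (pathAbove-corner n 2 (a + b) c w) ⟩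
  aboveᵇ n 0 0 ∧ (aboveᵇ n 1 a ∧ (aboveᵇ n 2 (a + b) ∧ pathAbove n 3 (a + b + c) w)) ∎
  where open ≡-Reasoning

last-column-empty : ∀ n a b c d → a + (b + (c + d)) ≡ n → n * 3 ≤ 3 * (a + b + c) → d ≡ 0
last-column-empty n a b c zero    _     _ = refl
last-column-empty n a b c (suc d) refl le = ⊥-elim (m+1+n≰m (3 * (a + b + c)) (subst (_≤ 3 * (a + b + c)) (expand a b c d) le))
  where
  expand : ∀ a b c d → (a + (b + (c + suc d))) * 3 ≡ 3 * (a + b + c) + suc (3 * d + 2)
  expand = solve-∀

isDyck⇒path : ∀ n w → isDyck n w ≡ true → Σ[ t ∈ DyckTriple n ] let open DyckTriple t in w ≡ path a b c
isDyck⇒path n w dyck with ∧-true⁻ _ (trans (sym (isDyck≡pathAbove n w)) dyck)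
... | counts , above with ∧-true⁻ _ counts
... | threeE , nN with split-at-E w 2 (≡ᵇ-sound threeE)
... | a , w₁ , refl , e₁ with split-at-E w₁ 1 e₁
... | b , w₂ , refl , e₂ with split-at-E w₂ 0 e₂
... | c , w₃ , refl , e₃ = triple a b c total col₁ col₂ , cong (λ w′ → Ns a ++ E ∷ Ns b ++ E ∷ Ns c ++ E ∷ w′) w₃≡[]
  where
  d = countN w₃
  corners = proj₂ (∧-true⁻ (aboveᵇ n 0 0) (trans (sym (pathAbove-corners n a b c w₃)) above))
  col₁ = ≤ᵇ-sound (proj₁ (∧-true⁻ (aboveᵇ n 1 a) corners))
  corners₂₃ = ∧-true⁻ (aboveᵇ n 2 (a + b)) (proj₂ (∧-true⁻ (aboveᵇ n 1 a) corners))
  col₂ = ≤ᵇ-sound (proj₁ corners₂₃)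
  total₄ : a + (b + (c + d)) ≡ n
  total₄ = trans (sym (trans (countN-Ns a _) (cong (a +_) (trans (countN-Ns b _) (cong (b +_) (countN-Ns c _)))))) (≡ᵇ-sound nN)
  d≡0 : d ≡ 0
  d≡0 = last-column-empty n a b c d total₄ (≤ᵇ-sound (pathAbove-head n 3 (a + b + c) w₃ (proj₂ corners₂₃)))
  w₃≡[] : w₃ ≡ []
  w₃≡[] = trans (countE≡0⇒Ns w₃ e₃) (cong Ns d≡0)
  total : a + (b + c) ≡ n
  total = trans (cong (λ z → a + (b + z)) (sym (+-identityʳ c))) (subst (λ d′ → a + (b + (c + d′)) ≡ n) d≡0 total₄)

countE-path : ∀ a b c → countE (path a b c) ≡ 3
countE-path a b c rewrite countE-Ns a (E ∷ Ns b ++ E ∷ Ns c ++ E ∷ []) | countE-Ns b (E ∷ Ns c ++ E ∷ []) | countE-Ns c (E ∷ []) = refl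

countN-path : ∀ a b c → countN (path a b c) ≡ a + (b + c)
countN-path a b c rewrite countN-Ns a (E ∷ Ns b ++ E ∷ Ns c ++ E ∷ []) | countN-Ns b (E ∷ Ns c ++ E ∷ []) | countN-Ns c (E ∷ []) | +-identityʳ c = refl

path-isDyck : ∀ {n} (t : DyckTriple n) → let open DyckTriple t in isDyck n (path a b c) ≡ true
path-isDyck {n} (triple a b c total col₁ col₂) = begin
  isDyck n (path a b c)
    ≡⟨ isDyck≡pathAbove n (path a b c) ⟩
  ((countE (path a b c) ≡ᵇ 3) ∧ (countN (path a b c) ≡ᵇ n)) ∧ pathAbove n 0 0 (path a b c)
    ≡⟨ cong₂ _∧_ (∧-true⁺ (≡ᵇ-true (countE-path a b c)) (≡ᵇ-true (trans (countN-path a b c) total))) (pathAbove-corners n a b c []) ⟩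
  true ∧ (aboveᵇ n 0 0 ∧ (aboveᵇ n 1 a ∧ (aboveᵇ n 2 (a + b) ∧ aboveᵇ n 3 (a + b + c))))
    ≡⟨ ∧-true⁺ origin (∧-true⁺ (≤ᵇ-true col₁) (∧-true⁺ (≤ᵇ-true col₂) (≤ᵇ-true (≤-reflexive end)))) ⟩
  true ∎
  where
  open ≡-Reasoning
  origin : aboveᵇ n 0 0 ≡ true
  origin rewrite *-zeroʳ n = refl
  end : n * 3 ≡ 3 * (a + b + c)
  end = trans (cong (_* 3) (sym total)) (reassoc a b c)
    where
    reassoc : ∀ a b c → (a + (b + c)) * 3 ≡ 3 * (a + b + c)
    reassoc = solve-∀

length-path : ∀ a b c → length (path a b c) ≡ a + (b + c) + 3
length-path a b c
  rewrite length-++ (Ns a) {E ∷ Ns b ++ E ∷ Ns c ++ E ∷ []} | length-++ (Ns b) {E ∷ Ns c ++ E ∷ []} | length-++ (Ns c) {E ∷ []}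
        | length-replicate a {N} | length-replicate b {N} | length-replicate c {N} = lemma a b c
  where
  lemma : ∀ a b c → a + suc (b + suc (c + 1)) ≡ a + (b + c) + 3
  lemma = solve-∀

-- dinv and area of N^a E N^b E N^c E

column : (ℕ × ℕ → Bool) → ℕ → ℕ → ℕ
column P x n = countBelow (λ k → P (x , suc k)) n

countᵇ-cells : ∀ P n → countᵇ P (cells n) ≡ column P 1 n + (column P 2 n + (column P 3 n + 0))
countᵇ-cells P n =
  trans (countᵇ-++ P (map (1 ,_) (oneTo n)) _) (cong₂ _+_ (column≡ 1)
  (trans (countᵇ-++ P (map (2 ,_) (oneTo n)) _) (cong₂ _+_ (column≡ 2)
  (trans (countᵇ-++ P (map (3 ,_) (oneTo n)) _) (cong₂ _+_ (column≡ 3) refl)))))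
  where
  column≡ : ∀ x → countᵇ P (map (x ,_) (oneTo n)) ≡ column P x n
  column≡ x = trans (countᵇ-map P (x ,_) (oneTo n)) (countᵇ-oneTo (λ b → P (x , b)) n)

height-Ns : ∀ a w k → height (Ns a ++ w) k ≡ a + height w k
height-Ns zero    w k = refl
height-Ns (suc a) w k = cong suc (height-Ns a w k)

height₁ : ∀ a b c → height (path a b c) 1 ≡ a
height₁ a b c = trans (height-Ns a _ 1) (+-identityʳ a)

height₂ : ∀ a b c → height (path a b c) 2 ≡ a + b
height₂ a b c = trans (height-Ns a _ 2) (cong (a +_) (trans (height-Ns b _ 1) (+-identityʳ b)))

height₃ : ∀ a b c → height (path a b c) 3 ≡ a + (b + c)
height₃ a b c = trans (height-Ns a _ 3) (cong (a +_) (trans (height-Ns b _ 2) (cong (b +_) (trans (height-Ns c _ 1) (+-identityʳ c)))))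

leg-above-height : ∀ n w x h l r → height w x ≡ h → h + (l + r) ≡ n → leg n w x (suc (h + l)) ≡ l
leg-above-height n w x h l r hx total = begin
  leg n w x (suc (h + l))                      ≡⟨ countᵇ-oneTo _ n ⟩
  countBelow below n                           ≡⟨ cong (countBelow below) (sym total) ⟩
  countBelow below (h + (l + r))               ≡⟨ countBelow-block h l r under between over ⟩
  l                                            ∎
  where
  open ≡-Reasoning
  below : ℕ → Bool
  below k = (suc k <ᵇ suc (h + l)) ∧ (height w x <ᵇ suc k)
  under : ∀ k → k < h → below k ≡ false
  under k k<h rewrite hx | <ᵇ-false {h} {suc k} k<h = ∧-zeroʳ _
  between : ∀ k → k < l → below (h + k) ≡ true
  between k k<l rewrite hx = ∧-true⁺ (<ᵇ-true (+-monoʳ-< h k<l)) (<ᵇ-true (s≤s (m≤m+n h k)))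
  over : ∀ k → k < r → below (h + (l + k)) ≡ false
  over k _ rewrite <ᵇ-false {h + (l + k)} {h + l} (+-monoʳ-≤ h (m≤m+n l k)) = refl

dinvCell : ℕ → List Step → ℕ × ℕ → Bool
dinvCell n w c = inLambda w (proj₁ c) (proj₂ c) ∧ dinvCond n (arm n w (proj₁ c) (proj₂ c)) (leg n w (proj₁ c) (proj₂ c))

areaCell : ℕ → List Step → ℕ × ℕ → Bool
areaCell n w c = (proj₂ c ≤ᵇ height w (proj₁ c)) ∧ ((n * proj₁ c) ≤ᵇ (3 * (proj₂ c ∸ 1)))

indicator : Bool → ℕ
indicator true  = 1
indicator false = 0

arm₁ : ∀ n w y → arm n w 1 y ≡ indicator (inLambda w 2 y) + indicator (inLambda w 3 y)
arm₁ n w y with inLambda w 2 y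
... | true with inLambda w 3 y
...   | true  = refl
...   | false = refl
arm₁ n w y | false with inLambda w 3 y
...   | true  = refl
...   | false = refl

arm₂ : ∀ n w y → arm n w 2 y ≡ indicator (inLambda w 3 y)
arm₂ n w y with inLambda w 3 y
... | true  = refl
... | false = refl

module _ {n a b c : ℕ} (total : a + (b + c) ≡ n) where

  private
    w = path a b c
    h₁ = height₁ a b c
    h₂ = height₂ a b c
    h₃ = trans (height₃ a b c) total

  dinv-column₃ : column (dinvCell n w) 3 n ≡ 0
  dinv-column₃ = countBelow-false n (λ k k<n → cell k k<n)
    where
    cell : ∀ k → k < n → dinvCell n w (3 , suc k) ≡ false
    cell k k<n rewrite h₃ | <ᵇ-false {n} {suc k} k<n = refl

  dinv-column₂ : column (dinvCell n w) 2 n ≡ countBelow (dinvCond n 0) c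
  dinv-column₂ = begin
    column (dinvCell n w) 2 n                    ≡⟨ cong (column (dinvCell n w) 2) (trans (sym total) (sym (+-assoc a b c))) ⟩
    column (dinvCell n w) 2 (a + b + c)          ≡⟨ countBelow-+ _ (a + b) c ⟩
    column (dinvCell n w) 2 (a + b) + _          ≡⟨ cong₂ _+_ (countBelow-false (a + b) below) (countBelow-cong c inside) ⟩
    countBelow (dinvCond n 0) c                  ∎
    where
    open ≡-Reasoning
    below : ∀ k → k < a + b → dinvCell n w (2 , suc k) ≡ false
    below k k<ab rewrite h₂ | <ᵇ-false {a + b} {suc k} k<ab = refl
    inside : ∀ l → l < c → dinvCell n w (2 , suc (a + b + l)) ≡ dinvCond n 0 l
    inside l l<c
      rewrite arm₂ n w (suc (a + b + l))
            | leg-above-height n w 2 (a + b) l (c ∸ l) h₂ (trans (+-assoc a b _) (trans (cong (λ z → a + (b + z)) (m+[n∸m]≡n (<⇒≤ l<c))) total))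
            | h₃ | h₂
            | <ᵇ-true {a + b} {suc (a + b + l)} (s≤s (m≤m+n (a + b) l))
            | <ᵇ-false {n} {suc (a + b + l)} (subst (suc (a + b + l) ≤_) total (subst (_≤ a + (b + c)) (sym (cong suc (+-assoc a b l))) (+-monoʳ-< a (+-monoʳ-< b l<c))))
            = refl

  dinv-column₁ : column (dinvCell n w) 1 n ≡ countBelow (dinvCond n 0) b + countBelow (λ l → dinvCond n 1 (b + l)) c
  dinv-column₁ = begin
    column (dinvCell n w) 1 n                    ≡⟨ cong (column (dinvCell n w) 1) (sym total) ⟩
    column (dinvCell n w) 1 (a + (b + c))        ≡⟨ countBelow-+ _ a (b + c) ⟩
    column (dinvCell n w) 1 a + _                ≡⟨ cong₂ _+_ (countBelow-false a below) (countBelow-+ _ b c) ⟩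
    countBelow (λ k → dinvCell n w (1 , suc (a + k))) b + countBelow (λ k → dinvCell n w (1 , suc (a + (b + k)))) c
                                                 ≡⟨ cong₂ _+_ (countBelow-cong b arm-free) (countBelow-cong c arm-one) ⟩
    countBelow (dinvCond n 0) b + countBelow (λ l → dinvCond n 1 (b + l)) c ∎
    where
    open ≡-Reasoning
    below : ∀ k → k < a → dinvCell n w (1 , suc k) ≡ false
    below k k<a rewrite h₁ | <ᵇ-false {a} {suc k} k<a = refl
    arm-free : ∀ l → l < b → dinvCell n w (1 , suc (a + l)) ≡ dinvCond n 0 l
    arm-free l l<b
      rewrite arm₁ n w (suc (a + l))
            | leg-above-height n w 1 a l ((b + c) ∸ l) h₁ (trans (cong (a +_) (m+[n∸m]≡n (≤-trans (<⇒≤ l<b) (m≤m+n b c)))) total)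
            | h₁ | h₂ | height₃ a b c
            | <ᵇ-true {a} {suc (a + l)} (s≤s (m≤m+n a l))
            | <ᵇ-false {a + b} {suc (a + l)} (+-monoʳ-< a l<b)
            | <ᵇ-false {a + (b + c)} {suc (a + l)} (+-monoʳ-< a (≤-trans l<b (m≤m+n b c)))
            = refl
    arm-one : ∀ l → l < c → dinvCell n w (1 , suc (a + (b + l))) ≡ dinvCond n 1 (b + l)
    arm-one l l<c
      rewrite arm₁ n w (suc (a + (b + l)))
            | leg-above-height n w 1 a (b + l) (c ∸ l) h₁ (trans (cong (a +_) (trans (+-assoc b l (c ∸ l)) (cong (b +_) (m+[n∸m]≡n (<⇒≤ l<c))))) total)
            | h₁ | h₂ | height₃ a b c
            | <ᵇ-true {a} {suc (a + (b + l))} (s≤s (m≤m+n a (b + l)))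
            | <ᵇ-true {a + b} {suc (a + (b + l))} (s≤s (subst (a + b ≤_) (+-assoc a b l) (m≤m+n (a + b) l)))
            | <ᵇ-false {a + (b + c)} {suc (a + (b + l))} (+-monoʳ-< a (+-monoʳ-< b l<c))
            = refl

  area-column : ∀ x h r → height w x ≡ h → h + r ≡ n → column (areaCell n w) x n ≡ countBelow (λ k → n * x ≤ᵇ 3 * k) h
  area-column x h r hx hr = begin
    column (areaCell n w) x n                    ≡⟨ cong (column (areaCell n w) x) (sym hr) ⟩
    column (areaCell n w) x (h + r)              ≡⟨ countBelow-+ _ h r ⟩
    column (areaCell n w) x h + _                ≡⟨ cong₂ _+_ (countBelow-cong h inside) (countBelow-false r over) ⟩
    countBelow (λ k → n * x ≤ᵇ 3 * k) h + 0      ≡⟨ +-identityʳ _ ⟩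
    countBelow (λ k → n * x ≤ᵇ 3 * k) h          ∎
    where
    open ≡-Reasoning
    inside : ∀ k → k < h → areaCell n w (x , suc k) ≡ (n * x ≤ᵇ 3 * k)
    inside k k<h rewrite hx | <ᵇ-true {k} {h} k<h = refl
    over : ∀ k → k < r → areaCell n w (x , suc (h + k)) ≡ false
    over k _ rewrite hx | <ᵇ-false {h + k} {h} (m≤m+n h k) = refl

  dinv-path : dinv n w ≡ countBelow (dinvCond n 0) b + countBelow (λ l → dinvCond n 1 (b + l)) c + countBelow (dinvCond n 0) c
  dinv-path = trans (countᵇ-cells (dinvCell n w) n) (cong₂ _+_ dinv-column₁ (trans (cong₂ _+_ dinv-column₂ (cong (_+ 0) dinv-column₃)) (+-identityʳ _)))

  area-path : area n w ≡ countBelow (λ k → n * 1 ≤ᵇ 3 * k) a + countBelow (λ k → n * 2 ≤ᵇ 3 * k) (a + b)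
  area-path = trans (countᵇ-cells (areaCell n w) n) (cong₂ _+_ (area-column 1 a (b + c) h₁ total)
    (trans (cong₂ _+_ (area-column 2 (a + b) c h₂ (trans (+-assoc a b c) total)) (cong (_+ 0) (trans (area-column 3 n 0 h₃ (+-identityʳ n)) column₃-empty)))
      (+-identityʳ _)))
    where
    column₃-empty : countBelow (λ k → n * 3 ≤ᵇ 3 * k) n ≡ 0
    column₃-empty = countBelow-false n (λ k k<n → ≤ᵇ-false (subst (3 * k <_) (*-comm 3 n) (*-monoʳ-< 3 k<n)))

-- The case n = 3m + 1 + e

dinvValue : ℕ → ℕ → ℕ → ℕ
dinvValue m b c = b ⊓ suc m + (c ∸ (m ∸ b)) + c ⊓ suc m

areaValue : ℕ → ℕ → ℕ → ℕ → ℕ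
areaValue m e a b = (a ∸ suc m) + ((a + b) ∸ suc (2 * m + e))

module _ {m e : ℕ} (e≤1 : e ≤ 1) where

  private
    n = suc (3 * m + e)

  3m<n : 3 * m < n
  3m<n = s≤s (m≤m+n (3 * m) e)

  n<3[1+m] : n < 3 * suc m
  n<3[1+m] = subst (suc n ≤_) (expand m) (s≤s (s≤s (+-monoʳ-≤ (3 * m) e≤1)))
    where
    expand : ∀ m → suc (suc (3 * m + 1)) ≡ 3 * suc m
    expand = solve-∀

  3[2m+e]<2n : 3 * (2 * m + e) < n * 2
  3[2m+e]<2n = begin-strict
    3 * (2 * m + e)          <⟨ n<1+n _ ⟩
    suc (3 * (2 * m + e))    ≡⟨ expand₁ m e ⟩
    suc (6 * m + 2 * e) + e  ≤⟨ +-monoʳ-≤ _ e≤1 ⟩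
    suc (6 * m + 2 * e) + 1  ≡⟨ expand₂ m e ⟩
    n * 2                    ∎
    where
    open ≤-Reasoning
    expand₁ : ∀ m e → suc (3 * (2 * m + e)) ≡ suc (6 * m + 2 * e) + e
    expand₁ = solve-∀
    expand₂ : ∀ m e → suc (6 * m + 2 * e) + 1 ≡ suc (3 * m + e) * 2
    expand₂ = solve-∀

  2n≤3[1+2m+e] : n * 2 ≤ 3 * suc (2 * m + e)
  2n≤3[1+2m+e] = subst (n * 2 ≤_) (expand m e) (m≤m+n (n * 2) (suc e))
    where
    expand : ∀ m e → suc (3 * m + e) * 2 + suc e ≡ 3 * suc (2 * m + e)
    expand = solve-∀

  column₁-threshold : ∀ {k} → n * 1 ≤ 3 * k → suc m ≤ k
  column₁-threshold {k} h = *-cancelˡ-< 3 m k (<-≤-trans 3m<n (subst (_≤ 3 * k) (*-identityʳ n) h))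

  column₁-threshold⁻ : ∀ {k} → suc m ≤ k → n * 1 ≤ 3 * k
  column₁-threshold⁻ {k} h = subst (_≤ 3 * k) (sym (*-identityʳ n)) (<⇒≤ (<-≤-trans n<3[1+m] (*-monoʳ-≤ 3 h)))

  column₂-threshold : ∀ {k} → n * 2 ≤ 3 * k → suc (2 * m + e) ≤ k
  column₂-threshold {k} h = *-cancelˡ-< 3 _ k (<-≤-trans 3[2m+e]<2n h)

  column₂-threshold⁻ : ∀ {k} → suc (2 * m + e) ≤ k → n * 2 ≤ 3 * k
  column₂-threshold⁻ h = ≤-trans 2n≤3[1+2m+e] (*-monoʳ-≤ 3 h)

  private
    0<3[l+1] : ∀ l → 0 < 3 * (l + 1)
    0<3[l+1] l rewrite +-comm l 1 = z<s

  dinvCond-arm₀ : ∀ l → dinvCond n 0 l ≡ (l <ᵇ suc m)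
  dinvCond-arm₀ l = Bool-ext (to l) from
    where
    to : ∀ l → dinvCond n 0 l ≡ true → (l <ᵇ suc m) ≡ true
    to zero    _ = refl
    to (suc l) h = <ᵇ-true (*-cancelˡ-< 3 (suc l) (suc m) (<-trans (subst (3 * suc l <_) (*-identityˡ n) (<ᵇ-sound (proj₂ (∧-true⁻ _ h)))) n<3[1+m]))
    from : (l <ᵇ suc m) ≡ true → dinvCond n 0 l ≡ true
    from h = ∧-true⁺ (<ᵇ-true (0<3[l+1] l)) (trans (cong ((l ≡ᵇ 0) ∨_) (<ᵇ-true 3l<n)) (∨-zeroʳ _))
      where
      3l<n : 3 * l < 1 * n
      3l<n = subst (3 * l <_) (sym (*-identityˡ n)) (≤-<-trans (*-monoʳ-≤ 3 (m<1+n⇒m≤n (<ᵇ-sound {l} h))) 3m<n)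

  dinvCond-arm₁ : ∀ L → L ≤ 2 * m + e → dinvCond n 1 L ≡ (m ≤ᵇ L)
  dinvCond-arm₁ L L≤ = Bool-ext to from
    where
    to : dinvCond n 1 L ≡ true → (m ≤ᵇ L) ≡ true
    to h = ≤ᵇ-true (m<1+n⇒m≤n (subst (m <_) (+-comm L 1) (*-cancelˡ-< 3 _ _
             (<-trans 3m<n (subst (_< 3 * (L + 1)) (*-identityˡ n) (<ᵇ-sound (proj₁ (∧-true⁻ _ h))))))))
    from : (m ≤ᵇ L) ≡ true → dinvCond n 1 L ≡ true
    from h = ∧-true⁺ (<ᵇ-true n<3[L+1]) (trans (cong ((L ≡ᵇ 0) ∨_) (<ᵇ-true 3L<2n)) (∨-zeroʳ _))
      where
      n<3[L+1] : 1 * n < 3 * (L + 1)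
      n<3[L+1] = subst₂ _<_ (sym (*-identityˡ n)) (cong (3 *_) (+-comm 1 L)) (<-≤-trans n<3[1+m] (*-monoʳ-≤ 3 (s≤s (≤ᵇ-sound h))))
      3L<2n : 3 * L < 2 * n
      3L<2n = subst (3 * L <_) (*-comm n 2) (≤-<-trans (*-monoʳ-≤ 3 L≤) 3[2m+e]<2n)

  dinv-closed : ∀ {a b c} → a + (b + c) ≡ n → suc m ≤ a → dinv n (path a b c) ≡ dinvValue m b c
  dinv-closed {a} {b} {c} total a-tall = begin
    dinv n (path a b c)
      ≡⟨ dinv-path {n} {a} {b} {c} total ⟩
    countBelow (dinvCond n 0) b + countBelow (λ l → dinvCond n 1 (b + l)) c + countBelow (dinvCond n 0) c
      ≡⟨ cong₂ _+_ (cong₂ _+_ (arm₀-count b) arm₁-count) (arm₀-count c) ⟩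
    b ⊓ suc m + (c ∸ (m ∸ b)) + c ⊓ suc m ∎
    where
    open ≡-Reasoning
    arm₀-count : ∀ k → countBelow (dinvCond n 0) k ≡ k ⊓ suc m
    arm₀-count k = trans (countBelow-cong k (λ l _ → dinvCond-arm₀ l)) (countBelow-<ᵇ (suc m) k)
    b+c≤2m+e : b + c ≤ 2 * m + e
    b+c≤2m+e = +-cancelˡ-≤ (suc m) _ _ (subst (suc m + (b + c) ≤_) (trans total (split m e)) (+-monoˡ-≤ (b + c) a-tall))
      where
      split : ∀ m e → suc (3 * m + e) ≡ suc m + (2 * m + e)
      split = solve-∀
    arm₁-count : countBelow (λ l → dinvCond n 1 (b + l)) c ≡ c ∸ (m ∸ b)
    arm₁-count = trans (countBelow-cong c (λ l l<c → trans (dinvCond-arm₁ (b + l) (≤-trans (<⇒≤ (+-monoʳ-< b l<c)) b+c≤2m+e))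
                                                            (≤ᵇ-cong (m≤n+o⇒m∸n≤o m b) (λ h → ≤-trans (m≤n+m∸n m b) (+-monoʳ-≤ b h)))))
                       (countBelow-≤ᵇ (m ∸ b) c)

  area-closed : ∀ {a b c} → a + (b + c) ≡ n → area n (path a b c) ≡ areaValue m e a b
  area-closed {a} {b} {c} total = trans (area-path {n} {a} {b} {c} total) (cong₂ _+_
    (trans (countBelow-cong {λ k → n * 1 ≤ᵇ 3 * k} {suc m ≤ᵇ_} a (λ k _ → ≤ᵇ-cong (column₁-threshold {k}) column₁-threshold⁻)) (countBelow-≤ᵇ (suc m) a))
    (trans (countBelow-cong {λ k → n * 2 ≤ᵇ 3 * k} {suc (2 * m + e) ≤ᵇ_} (a + b) (λ k _ → ≤ᵇ-cong (column₂-threshold {k}) column₂-threshold⁻)) (countBelow-≤ᵇ (suc (2 * m + e)) (a + b))))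

-- The three families of Dyck paths

Runs : Set
Runs = ℕ × ℕ × ℕ

IsDyckRuns : ℕ → ℕ → Runs → Set
IsDyckRuns m e (a , b , c) = a + (b + c) ≡ suc (3 * m + e) × suc m ≤ a × suc (2 * m + e) ≤ a + b

-- The Dyck paths for n = 3m + 1 + e in free parameters, indexed by m: low has b + c ≤ m,
-- mid has b ≤ m < b + c and high has m < b.
data Piece (e : ℕ) : ℕ → Set where
  low  : ∀ b c u → Piece e (c + (b + u))
  mid  : ∀ y z t → Piece e (suc (z + t) + y)
  high : ∀ c x v → Piece e (c + (x + v + (1 ∸ e)))

-- The path is N^a E N^b E N^c E with a = suc m + area₁, b = run₂, c = run₃ and a + b = suc (2m + e) + area₂,
-- so area₁ and area₂ count the area cells in columns 1 and 2.
run₂ run₃ area₁ area₂ dinvOf : ∀ {e m} → Piece e m → ℕ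
run₂ (low b c u)  = b
run₂ (mid y z t)  = suc (y + z)
run₂ {m = m} (high c x v) = suc (m + v)
run₃ (low b c u)  = c
run₃ (mid y z t)  = suc (z + t)
run₃ (high c x v) = c
area₁ {e} (low b c u)  = b + c + (u + u) + e
area₁ {e} (mid y z t)  = t + y + e
area₁ (high c x v)     = x
area₂ (low b c u)      = b + u
area₂ (mid y z t)      = y
area₂ {e} (high c x v) = x + v + (1 ∸ e)
dinvOf (low b c u)  = b + c
dinvOf (mid y z t)  = suc (y + z) + suc z + suc (z + t)
dinvOf {m = m} (high c x v) = suc m + c + c

areaOf : ∀ {e m} → Piece e m → ℕ
areaOf π = area₁ π + area₂ π

runs : ∀ {e m} → Piece e m → Runs
runs {m = m} π = suc (m + area₁ π) , run₂ π , run₃ π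

Support : ℕ → ℕ → ℕ → Set
Support K i j = i + j ≤ K × K ≤ 2 * i + j × K ≤ i + 2 * j

support? : ∀ K i j → Dec (Support K i j)
support? K i j = (i + j ≤? K) ×-dec (K ≤? 2 * i + j) ×-dec (K ≤? i + 2 * j)

support-sym : ∀ {K i j} → Support K i j → Support K j i
support-sym {K} {i} {j} (i+j≤K , K≤2i+j , K≤i+2j) =
  subst (_≤ K) (+-comm i j) i+j≤K , subst (K ≤_) (+-comm i (2 * j)) K≤i+2j , subst (K ≤_) (+-comm (2 * i) j) K≤2i+j

slack⇒support : ∀ {K i j} r → r + (i + j) ≡ K → r ≤ i → r ≤ j → Support K i j
slack⇒support {i = i} {j} r refl r≤i r≤j =
  m≤n+m (i + j) r ,
  ≤-trans (+-monoˡ-≤ (i + j) r≤i) (≤-reflexive (double-i i j)) ,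
  ≤-trans (≤-reflexive (swap r i j)) (≤-trans (+-monoʳ-≤ i (+-monoˡ-≤ j r≤j)) (≤-reflexive (double-j i j)))
  where
  double-i : ∀ i j → i + (i + j) ≡ 2 * i + j
  double-i = solve-∀
  swap : ∀ r i j → r + (i + j) ≡ i + (r + j)
  swap = solve-∀
  double-j : ∀ i j → i + (j + j) ≡ i + 2 * j
  double-j = solve-∀

support⇒slack : ∀ {K i j} → Support K i j → Σ[ r ∈ ℕ ] r + (i + j) ≡ K × r ≤ i × r ≤ j
support⇒slack {i = i} {j} (i+j≤K , K≤2i+j , K≤i+2j) with m≤n⇒∃[o]m+o≡n i+j≤K
... | r , refl = r , +-comm r (i + j) ,
  +-cancelˡ-≤ (i + j) r i (≤-trans K≤2i+j (≤-reflexive (extra-i i j))) ,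
  +-cancelˡ-≤ (i + j) r j (≤-trans K≤i+2j (≤-reflexive (extra-j i j)))
  where
  extra-i : ∀ i j → 2 * i + j ≡ i + j + i
  extra-i = solve-∀
  extra-j : ∀ i j → i + 2 * j ≡ i + j + j
  extra-j = solve-∀

piece-index : ∀ {e m} (π : Piece e m) → run₃ π + area₂ π ≡ m
piece-index (low b c u)  = refl
piece-index (mid y z t)  = refl
piece-index (high c x v) = refl

piece-second-run : ∀ {e m} → e ≤ 1 → (π : Piece e m) → suc (m + area₁ π) + run₂ π ≡ suc (2 * m + e) + area₂ π
piece-second-run {e} _ (low b c u) = lemma b c u e
  where
  lemma : ∀ b c u e → suc (c + (b + u) + (b + c + (u + u) + e)) + b ≡ suc (2 * (c + (b + u)) + e) + (b + u)
  lemma = solve-∀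
piece-second-run {e} _ (mid y z t) = lemma y z t e
  where
  lemma : ∀ y z t e → suc (suc (z + t) + y + (t + y + e)) + suc (y + z) ≡ suc (2 * (suc (z + t) + y) + e) + y
  lemma = solve-∀
piece-second-run z≤n (high c x v) = lemma c x v
  where
  lemma : ∀ c x v → suc (c + (x + v + 1) + x) + suc (c + (x + v + 1) + v) ≡ suc (2 * (c + (x + v + 1)) + 0) + (x + v + 1)
  lemma = solve-∀
piece-second-run (s≤s z≤n) (high c x v) = lemma c x v
  where
  lemma : ∀ c x v → suc (c + (x + v + 0) + x) + suc (c + (x + v + 0) + v) ≡ suc (2 * (c + (x + v + 0)) + 1) + (x + v + 0)
  lemma = solve-∀

piece-total : ∀ {e m} → e ≤ 1 → (π : Piece e m) → suc (m + area₁ π) + (run₂ π + run₃ π) ≡ suc (3 * m + e)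
piece-total {e} {m} e≤1 π = begin
  suc (m + area₁ π) + (run₂ π + run₃ π)   ≡⟨ sym (+-assoc (suc (m + area₁ π)) _ _) ⟩
  suc (m + area₁ π) + run₂ π + run₃ π     ≡⟨ cong (_+ run₃ π) (piece-second-run e≤1 π) ⟩
  suc (2 * m + e) + area₂ π + run₃ π      ≡⟨ +-assoc (suc (2 * m + e)) _ _ ⟩
  suc (2 * m + e) + (area₂ π + run₃ π)    ≡⟨ cong (suc (2 * m + e) +_) (trans (+-comm (area₂ π) _) (piece-index π)) ⟩
  suc (2 * m + e) + m                     ≡⟨ lemma m e ⟩
  suc (3 * m + e)                         ∎
  where
  open ≡-Reasoning
  lemma : ∀ m e → suc (2 * m + e) + m ≡ suc (3 * m + e)
  lemma = solve-∀

piece-dyck : ∀ {e m} → e ≤ 1 → (π : Piece e m) → IsDyckRuns m e (runs π)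
piece-dyck {m = m} e≤1 π = piece-total e≤1 π , s≤s (m≤m+n m (area₁ π)) , ≤-witness (area₂ π) (sym (piece-second-run e≤1 π))

piece-area : ∀ {e m} → e ≤ 1 → (π : Piece e m) → areaValue m e (suc (m + area₁ π)) (run₂ π) ≡ areaOf π
piece-area {e} {m} e≤1 π = cong₂ _+_ (m+n∸m≡n (suc m) (area₁ π))
  (trans (cong (_∸ suc (2 * m + e)) (piece-second-run e≤1 π)) (m+n∸m≡n (suc (2 * m + e)) (area₂ π)))

⊓-suc : ∀ {k m} → k ≤ m → k ⊓ suc m ≡ k
⊓-suc k≤m = m≤n⇒m⊓n≡m (m≤n⇒m≤1+n k≤m)

piece-dinv : ∀ {e m} (π : Piece e m) → dinvValue m (run₂ π) (run₃ π) ≡ dinvOf π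
piece-dinv (low b c u) = begin
  b ⊓ suc m + (c ∸ (m ∸ b)) + c ⊓ suc m   ≡⟨ cong₂ (λ x y → x + (c ∸ y) + c ⊓ suc m) (⊓-suc b≤m) m∸b ⟩
  b + (c ∸ (c + u)) + c ⊓ suc m           ≡⟨ cong₂ (λ x y → b + x + y) (m≤n⇒m∸n≡0 (m≤m+n c u)) (⊓-suc (m≤m+n c (b + u))) ⟩
  b + 0 + c                               ≡⟨ cong (_+ c) (+-identityʳ b) ⟩
  b + c                                   ∎
  where
  open ≡-Reasoning
  m = c + (b + u)
  b≤m : b ≤ m
  b≤m = ≤-trans (m≤m+n b u) (m≤n+m (b + u) c)
  m∸b : m ∸ b ≡ c + u
  m∸b = trans (cong (_∸ b) (swap c b u)) (m+n∸m≡n b (c + u))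
    where
    swap : ∀ c b u → c + (b + u) ≡ b + (c + u)
    swap = solve-∀
piece-dinv (mid y z t) = begin
  b ⊓ suc m + (c ∸ (m ∸ b)) + c ⊓ suc m   ≡⟨ cong₂ (λ x y → x + (c ∸ y) + c ⊓ suc m) (⊓-suc (≤-witness t (sym m≡b+t))) (trans (cong (_∸ b) m≡b+t) (m+n∸m≡n b t)) ⟩
  b + (c ∸ t) + c ⊓ suc m                 ≡⟨ cong₂ (λ x y → b + x + y) (trans (cong (_∸ t) c≡t+1+z) (m+n∸m≡n t (suc z))) (⊓-suc (m≤m+n c y)) ⟩
  b + suc z + c                           ∎
  where
  open ≡-Reasoning
  m = suc (z + t) + y
  b = suc (y + z)
  c = suc (z + t)
  m≡b+t : m ≡ b + t
  m≡b+t = lemma y z t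
    where
    lemma : ∀ y z t → suc (z + t) + y ≡ suc (y + z) + t
    lemma = solve-∀
  c≡t+1+z : c ≡ t + suc z
  c≡t+1+z = lemma z t
    where
    lemma : ∀ z t → suc (z + t) ≡ t + suc z
    lemma = solve-∀
piece-dinv {m = m} (high c x v) = trans
  (cong₂ (λ x y → x + (c ∸ y) + c ⊓ suc m) (m≥n⇒m⊓n≡n (s≤s (m≤m+n m v))) (m≤n⇒m∸n≡0 (≤-trans (n≤1+n m) (s≤s (m≤m+n m v)))))
  (cong (suc m + c +_) (⊓-suc (m≤m+n c _)))

slack : ∀ {e m} → Piece e m → ℕ
slack (low b c u)  = c
slack (mid y z t)  = t
slack (high c x v) = v

piece-slack : ∀ {e m} → e ≤ 1 → (π : Piece e m) → slack π + (dinvOf π + areaOf π) ≡ 3 * m + e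
piece-slack {e} _ (low b c u) = lemma b c u e
  where
  lemma : ∀ b c u e → c + (b + c + (b + c + (u + u) + e + (b + u))) ≡ 3 * (c + (b + u)) + e
  lemma = solve-∀
piece-slack {e} _ (mid y z t) = lemma y z t e
  where
  lemma : ∀ y z t e → t + (suc (y + z) + suc z + suc (z + t) + (t + y + e + y)) ≡ 3 * (suc (z + t) + y) + e
  lemma = solve-∀
piece-slack z≤n (high c x v) = lemma c x v
  where
  lemma : ∀ c x v → v + (suc (c + (x + v + 1)) + c + c + (x + (x + v + 1))) ≡ 3 * (c + (x + v + 1)) + 0
  lemma = solve-∀
piece-slack (s≤s z≤n) (high c x v) = lemma c x v
  where
  lemma : ∀ c x v → v + (suc (c + (x + v + 0)) + c + c + (x + (x + v + 0))) ≡ 3 * (c + (x + v + 0)) + 1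
  lemma = solve-∀

slack≤dinv : ∀ {e m} (π : Piece e m) → slack π ≤ dinvOf π
slack≤dinv (low b c u)  = m≤n+m c b
slack≤dinv (mid y z t)  = ≤-witness (suc (y + 3 * z + 2)) (lemma y z t)
  where
  lemma : ∀ y z t → t + suc (y + 3 * z + 2) ≡ suc (y + z) + suc z + suc (z + t)
  lemma = solve-∀
slack≤dinv {e} (high c x v) = ≤-witness (suc (c + (x + (1 ∸ e))) + c + c) (lemma c x v (1 ∸ e))
  where
  lemma : ∀ c x v f → v + (suc (c + (x + f)) + c + c) ≡ suc (c + (x + v + f)) + c + c
  lemma = solve-∀

slack≤area : ∀ {e m} (π : Piece e m) → slack π ≤ areaOf π
slack≤area {e} (low b c u) = ≤-witness (b + (u + u) + e + (b + u)) (lemma b c u e)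
  where
  lemma : ∀ b c u e → c + (b + (u + u) + e + (b + u)) ≡ b + c + (u + u) + e + (b + u)
  lemma = solve-∀
slack≤area {e} (mid y z t) = ≤-witness (y + e + y) (lemma y t e)
  where
  lemma : ∀ y t e → t + (y + e + y) ≡ t + y + e + y
  lemma = solve-∀
slack≤area {e} (high c x v) = ≤-witness (x + x + (1 ∸ e)) (lemma x v (1 ∸ e))
  where
  lemma : ∀ x v f → v + (x + x + f) ≡ x + (x + v + f)
  lemma = solve-∀

piece-support : ∀ {e m} → e ≤ 1 → (π : Piece e m) → Support (3 * m + e) (dinvOf π) (areaOf π)
piece-support e≤1 π = slack⇒support (slack π) (piece-slack e≤1 π) (slack≤dinv π) (slack≤area π)

-- dinvOf π − m is at most 0 on low, positive and even on mid, odd on high.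
dinv-low : ∀ {e} b c u → dinvOf {e} (low b c u) + u ≡ c + (b + u)
dinv-low b c u = lemma b c u
  where
  lemma : ∀ b c u → b + c + u ≡ c + (b + u)
  lemma = solve-∀

dinv-mid : ∀ {e} y z t → dinvOf {e} (mid y z t) ≡ suc (z + t) + y + 2 * suc z
dinv-mid y z t = lemma y z t
  where
  lemma : ∀ y z t → suc (y + z) + suc z + suc (z + t) ≡ suc (z + t) + y + 2 * suc z
  lemma = solve-∀

dinv-high : ∀ {e} c x v → let m = c + (x + v + (1 ∸ e)) in dinvOf {e} (high c x v) ≡ suc (m + 2 * c)
dinv-high {e} c x v = lemma (c + (x + v + (1 ∸ e))) c
  where
  lemma : ∀ m c → suc m + c + c ≡ suc (m + 2 * c)
  lemma = solve-∀

low≢mid : ∀ {m i} u z → i + u ≡ m → i ≡ m + 2 * suc z → ⊥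
low≢mid {m} u z i+u≡m i≡ = m+1+n≢m m (trans (lemma m z u) (trans (cong (_+ u) (sym i≡)) i+u≡m))
  where
  lemma : ∀ m z u → m + suc (suc (2 * z + u)) ≡ m + 2 * suc z + u
  lemma = solve-∀

low≢high : ∀ {m i} u c → i + u ≡ m → i ≡ suc (m + 2 * c) → ⊥
low≢high {m} u c i+u≡m i≡ = m+1+n≢m m (trans (lemma m c u) (trans (cong (_+ u) (sym i≡)) i+u≡m))
  where
  lemma : ∀ m c u → m + suc (2 * c + u) ≡ suc (m + 2 * c) + u
  lemma = solve-∀

mid≢high : ∀ m z c → m + 2 * suc z ≢ suc (m + 2 * c)
mid≢high m z c eq = even≢odd (suc z) c (+-cancelˡ-≡ m _ _ (trans eq (sym (+-suc m (2 * c)))))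

low-injective : ∀ {e} b c u b′ c′ u′ → c + (b + u) ≡ c′ + (b′ + u′) → b + c ≡ b′ + c′ →
  areaOf {e} (low b c u) ≡ areaOf {e} (low b′ c′ u′) → b ≡ b′ × c ≡ c′ × u ≡ u′
low-injective {e} b c u b′ c′ u′ index dinv area = b≡b′ , c≡c′ , u≡u′
  where
  u≡u′ : u ≡ u′
  u≡u′ = +-cancelˡ-≡ (b′ + c′) u u′
    (trans (cong (_+ u) (sym dinv)) (trans (dinv-low {e} b c u) (trans index (sym (dinv-low {e} b′ c′ u′)))))
  regroup : ∀ b c u → b + c + (u + u) + e + (b + u) ≡ b + ((b + c) + (u + u + u + e))
  regroup b c u = solve (b ∷ c ∷ u ∷ e ∷ [])
  b≡b′ : b ≡ b′
  b≡b′ = +-cancelʳ-≡ _ b b′ (trans (sym (regroup b c u))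
    (trans area (trans (regroup b′ c′ u′) (cong₂ (λ s w → b′ + (s + (w + w + w + e))) (sym dinv) (sym u≡u′)))))
  c≡c′ : c ≡ c′
  c≡c′ = +-cancelˡ-≡ b c c′ (trans dinv (cong (_+ c′) (sym b≡b′)))

mid-injective : ∀ {e} y z t y′ z′ t′ → suc (z + t) + y ≡ suc (z′ + t′) + y′ → dinvOf {e} (mid y z t) ≡ dinvOf {e} (mid y′ z′ t′) →
  areaOf {e} (mid y z t) ≡ areaOf {e} (mid y′ z′ t′) → y ≡ y′ × z ≡ z′ × t ≡ t′
mid-injective {e} y z t y′ z′ t′ index dinv area = y≡y′ , z≡z′ , t≡t′
  where
  z≡z′ : z ≡ z′
  z≡z′ = suc-injective (*-cancelˡ-≡ (suc z) (suc z′) 2 (+-cancelˡ-≡ (suc (z′ + t′) + y′) _ _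
    (trans (cong (_+ 2 * suc z) (sym index)) (trans (sym (dinv-mid {e} y z t)) (trans dinv (dinv-mid {e} y′ z′ t′))))))
  split : ∀ z t y → suc (z + t) + y ≡ suc z + (t + y)
  split = solve-∀
  t+y : t + y ≡ t′ + y′
  t+y = +-cancelˡ-≡ (suc z) _ _ (trans (sym (split z t y)) (trans index (trans (split z′ t′ y′) (cong (λ w → suc w + (t′ + y′)) (sym z≡z′)))))
  regroup : ∀ t y → t + y + e + y ≡ (t + y) + (y + e)
  regroup t y = solve (t ∷ y ∷ e ∷ [])
  y≡y′ : y ≡ y′
  y≡y′ = +-cancelʳ-≡ e y y′ (+-cancelˡ-≡ (t + y) _ _
    (trans (sym (regroup t y)) (trans area (trans (regroup t′ y′) (cong (_+ (y′ + e)) (sym t+y))))))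
  t≡t′ : t ≡ t′
  t≡t′ = +-cancelʳ-≡ y t t′ (trans t+y (cong (t′ +_) (sym y≡y′)))

high-injective : ∀ {e} c x v c′ x′ v′ → c + (x + v + (1 ∸ e)) ≡ c′ + (x′ + v′ + (1 ∸ e)) →
  dinvOf {e} (high c x v) ≡ dinvOf {e} (high c′ x′ v′) → areaOf {e} (high c x v) ≡ areaOf {e} (high c′ x′ v′) →
  c ≡ c′ × x ≡ x′ × v ≡ v′
high-injective {e} c x v c′ x′ v′ index dinv area = c≡c′ , x≡x′ , v≡v′
  where
  c≡c′ : c ≡ c′
  c≡c′ = *-cancelˡ-≡ c c′ 2 (+-cancelˡ-≡ (c′ + (x′ + v′ + (1 ∸ e))) _ _ (suc-injective
    (trans (cong (λ m → suc (m + 2 * c)) (sym index)) (trans (sym (dinv-high {e} c x v)) (trans dinv (dinv-high {e} c′ x′ v′))))))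
  x+v : x + v ≡ x′ + v′
  x+v = +-cancelʳ-≡ (1 ∸ e) _ _ (+-cancelˡ-≡ c _ _ (trans index (cong (_+ (x′ + v′ + (1 ∸ e))) (sym c≡c′))))
  x≡x′ : x ≡ x′
  x≡x′ = +-cancelʳ-≡ (x + v + (1 ∸ e)) x x′ (trans area (cong (λ w → x′ + (w + (1 ∸ e))) (sym x+v)))
  v≡v′ : v ≡ v′
  v≡v′ = +-cancelˡ-≡ x v v′ (trans x+v (cong (_+ v′) (sym x≡x′)))

piece-injective : ∀ {e m m′} (π : Piece e m) (π′ : Piece e m′) → m ≡ m′ → dinvOf π ≡ dinvOf π′ → areaOf π ≡ areaOf π′ → runs π ≡ runs π′
piece-injective (low b c u) (low b′ c′ u′) index dinv area with low-injective b c u b′ c′ u′ index dinv area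
... | refl , refl , refl = refl
piece-injective (mid y z t) (mid y′ z′ t′) index dinv area with mid-injective y z t y′ z′ t′ index dinv area
... | refl , refl , refl = refl
piece-injective {e} (high c x v) (high c′ x′ v′) index dinv area with high-injective {e} c x v c′ x′ v′ index dinv area
... | refl , refl , refl = refl
piece-injective {e} (low b c u) (mid y z t) index dinv _ =
  ⊥-elim (low≢mid u z (dinv-low {e} b c u) (trans dinv (trans (dinv-mid {e} y z t) (cong (_+ 2 * suc z) (sym index)))))
piece-injective {e} (mid y z t) (low b c u) index dinv _ =
  ⊥-elim (low≢mid u z (dinv-low {e} b c u) (trans (sym dinv) (trans (dinv-mid {e} y z t) (cong (_+ 2 * suc z) index))))
piece-injective {e} (low b c u) (high c′ x v) index dinv _ =
  ⊥-elim (low≢high u c′ (dinv-low {e} b c u) (trans dinv (trans (dinv-high {e} c′ x v) (cong (λ k → suc (k + 2 * c′)) (sym index)))))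
piece-injective {e} (high c′ x v) (low b c u) index dinv _ =
  ⊥-elim (low≢high u c′ (dinv-low {e} b c u) (trans (sym dinv) (trans (dinv-high {e} c′ x v) (cong (λ k → suc (k + 2 * c′)) index))))
piece-injective {e} {m} (mid y z t) (high c x v) index dinv _ =
  ⊥-elim (mid≢high m z c (trans (sym (dinv-mid {e} y z t)) (trans dinv (trans (dinv-high {e} c x v) (cong (λ k → suc (k + 2 * c)) (sym index))))))
piece-injective {e} {m} (high c x v) (mid y z t) index dinv _ =
  ⊥-elim (mid≢high m z c (trans (cong (_+ 2 * suc z) index) (trans (sym (dinv-mid {e} y z t)) (trans (sym dinv) (dinv-high {e} c x v)))))

runs-from-last-two : ∀ {e m} → e ≤ 1 → (π : Piece e m) → ∀ {a b c} → a + (b + c) ≡ suc (3 * m + e) →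
  run₂ π ≡ b → run₃ π ≡ c → runs π ≡ (a , b , c)
runs-from-last-two {m = m} e≤1 π total refl refl =
  cong (_, run₂ π , run₃ π) (+-cancelʳ-≡ (run₂ π + run₃ π) _ _ (trans (piece-total e≤1 π) (sym total)))

third-run-short : ∀ {m e a b c} → IsDyckRuns m e (a , b , c) → c ≤ m
third-run-short {m} {e} {a} {b} {c} (total , _ , second-tall) = +-cancelˡ-≤ (suc (2 * m + e)) c m (begin
  suc (2 * m + e) + c   ≤⟨ +-monoˡ-≤ c second-tall ⟩
  a + b + c             ≡⟨ +-assoc a b c ⟩
  a + (b + c)           ≡⟨ total ⟩
  suc (3 * m + e)       ≡⟨ lemma m e ⟩
  suc (2 * m + e) + m   ∎)
  where
  open ≤-Reasoning
  lemma : ∀ m e → suc (3 * m + e) ≡ suc (2 * m + e) + m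
  lemma = solve-∀

m+e≡1+n⇒m≡n+1∸e : ∀ {e m n} → e ≤ 1 → m + e ≡ suc n → m ≡ n + (1 ∸ e)
m+e≡1+n⇒m≡n+1∸e {m = m} {n} z≤n       eq = trans (sym (+-identityʳ m)) (trans eq (+-comm 1 n))
m+e≡1+n⇒m≡n+1∸e {m = m} {n} (s≤s z≤n) eq = trans (suc-injective (trans (+-comm 1 m) eq)) (sym (+-identityʳ n))

high-balance : ∀ c y x v e → suc (c + y + x) + (suc (y + (c + v)) + c) ≡ suc (3 * (c + y) + e) → y + e ≡ suc (x + v)
high-balance c y x v e total = +-cancelˡ-≡ (3 * c + 2 * y + 1) _ _ (trans (sym (rhs c y e)) (trans (sym total) (sym (lhs c y x v))))
  where
  lhs : ∀ c y x v → 3 * c + 2 * y + 1 + suc (x + v) ≡ suc (c + y + x) + (suc (y + (c + v)) + c)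
  lhs = solve-∀
  rhs : ∀ c y e → suc (3 * (c + y) + e) ≡ 3 * c + 2 * y + 1 + (y + e)
  rhs = solve-∀

cover : ∀ {e} → e ≤ 1 → ∀ m a b c → IsDyckRuns m e (a , b , c) → Σ[ π ∈ Piece e m ] runs π ≡ (a , b , c)
cover e≤1 m a b c dyck@(total , _ , _) with m≤n⇒∃[o]m+o≡n (third-run-short dyck)
... | y , refl with ≤-<-connex b y
...   | inj₁ b≤y with m≤n⇒∃[o]m+o≡n b≤y
...     | u , refl = low b c u , runs-from-last-two e≤1 (low b c u) total refl refl
cover e≤1 m a b c dyck@(total , _ , _) | y , refl | inj₂ y<b with m≤n⇒∃[o]m+o≡n y<b
... | z , refl with <-≤-connex z c
...   | inj₁ z<c with m≤n⇒∃[o]m+o≡n z<c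
...     | t , refl = mid y z t , runs-from-last-two e≤1 (mid y z t) total refl refl
cover {e} e≤1 m a b c dyck@(total , first-tall , _) | y , refl | inj₂ y<b | z , refl | inj₂ c≤z
  with m≤n⇒∃[o]m+o≡n c≤z | m≤n⇒∃[o]m+o≡n first-tall
... | v , refl | x , refl with m+e≡1+n⇒m≡n+1∸e e≤1 (high-balance c y x v e total)
...   | refl = high c x v , runs-from-last-two e≤1 (high c x v) total (swap c y v) refl
  where
  swap : ∀ c y v → suc (c + y + v) ≡ suc (y + (c + v))
  swap = solve-∀

-- Every point of the support is attained

data EvenOrOdd : ℕ → Set where
  even : ∀ h → EvenOrOdd (2 * h)
  odd  : ∀ h → EvenOrOdd (suc (2 * h))

even-or-odd : ∀ n → EvenOrOdd n
even-or-odd zero = even 0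
even-or-odd (suc n) with even-or-odd n
... | even h = odd h
... | odd h  = subst EvenOrOdd (*-suc 2 h) (even (suc h))

even-sum : ∀ s h → 2 * s + 2 * h ≡ 2 * (s + h)
even-sum s h = sym (*-distribˡ-+ 2 s h)

odd-sum : ∀ s h → 2 * s + suc (2 * h) ≡ suc (2 * (s + h))
odd-sum s h = trans (+-suc (2 * s) (2 * h)) (cong suc (even-sum s h))

halve : ∀ {s q M e} → e ≤ 1 → 2 * s + q ≡ 2 * M + e → Σ[ h ∈ ℕ ] q ≡ 2 * h + e × M ≡ s + h
halve {s} {q} {M} e≤1 eq with even-or-odd q | e≤1
... | even h | z≤n     = h , sym (+-identityʳ (2 * h)) , sym (*-cancelˡ-≡ (s + h) M 2 (trans (sym (even-sum s h)) (trans eq (+-identityʳ (2 * M)))))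
... | even h | s≤s z≤n = ⊥-elim (even≢odd (s + h) M (trans (sym (even-sum s h)) (trans eq (+-comm (2 * M) 1))))
... | odd h  | z≤n     = ⊥-elim (even≢odd M (s + h) (sym (trans (sym (odd-sum s h)) (trans eq (+-identityʳ (2 * M))))))
... | odd h  | s≤s z≤n = h , +-comm 1 (2 * h) , sym (*-cancelˡ-≡ (s + h) M 2 (suc-injective (trans (sym (odd-sum s h)) (trans eq (+-comm (2 * M) 1)))))

high-double-sum : ∀ m r c q e → r + (suc (m + 2 * c) + (r + q)) ≡ 3 * m + e → 2 * (r + c) + suc q ≡ 2 * m + e
high-double-sum m r c q e sum = +-cancelˡ-≡ m _ _ (trans (lhs m r c q) (trans sum (rhs m e)))
  where
  lhs : ∀ m r c q → m + (2 * (r + c) + suc q) ≡ r + (suc (m + 2 * c) + (r + q))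
  lhs = solve-∀
  rhs : ∀ m e → 3 * m + e ≡ m + (2 * m + e)
  rhs = solve-∀

mid-double-sum : ∀ m r z q e → r + (suc (m + suc (2 * z)) + (r + q)) ≡ 3 * m + e → 2 * (r + suc z) + q ≡ 2 * m + e
mid-double-sum m r z q e sum = +-cancelˡ-≡ m _ _ (trans (lhs m r z q) (trans sum (rhs m e)))
  where
  lhs : ∀ m r z q → m + (2 * (r + suc z) + q) ≡ r + (suc (m + suc (2 * z)) + (r + q))
  lhs = solve-∀
  rhs : ∀ m e → 3 * m + e ≡ m + (2 * m + e)
  rhs = solve-∀

mid-shape : ∀ {e} → e ≤ 1 → ∀ m r z q → r + (suc (m + suc (2 * z)) + (r + q)) ≡ 3 * m + e → Σ[ y ∈ ℕ ] suc (z + r) + y ≡ m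
mid-shape {e} e≤1 m r z q sum with halve {r + suc z} {q} {m} e≤1 (mid-double-sum m r z q e sum)
... | y , _ , m≡ = y , sym (trans m≡ (reorder r z y))
  where
  reorder : ∀ r z y → r + suc z + y ≡ suc (z + r) + y
  reorder = solve-∀

high-shape : ∀ {e} → e ≤ 1 → ∀ m r c q → r + (suc (m + 2 * c) + (r + q)) ≡ 3 * m + e → Σ[ x ∈ ℕ ] c + (x + r + (1 ∸ e)) ≡ m
high-shape (s≤s z≤n) m r c q sum with halve {r + c} {suc q} {m} (s≤s z≤n) (high-double-sum m r c q 1 sum)
... | h , _ , m≡ = h , sym (trans m≡ (reorder₁ r c h))
  where
  reorder₁ : ∀ r c h → r + c + h ≡ c + (h + r + 0)
  reorder₁ = solve-∀
high-shape z≤n m r c q sum with halve {r + c} {suc q} {m} z≤n (high-double-sum m r c q 0 sum)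
... | suc x , _ , m≡ = x , sym (trans m≡ (reorder₀ r c x))
  where
  reorder₀ : ∀ r c x → r + c + suc x ≡ c + (x + r + 1)
  reorder₀ = solve-∀
... | zero , () , _

low-piece : ∀ {e} m r p u → r + p + u ≡ m → Σ[ π ∈ Piece e m ] slack π ≡ r × dinvOf π ≡ r + p
low-piece m r p u eq with trans (sym (+-assoc r p u)) eq
... | refl = low p r u , refl , +-comm p r

mid-piece : ∀ {e} m r z → Σ[ y ∈ ℕ ] suc (z + r) + y ≡ m → Σ[ π ∈ Piece e m ] slack π ≡ r × dinvOf π ≡ suc (m + suc (2 * z))
mid-piece {e} m r z (y , refl) = mid y z r , refl , trans (dinv-mid {e} y z r) (lemma (suc (z + r) + y) z)
  where
  lemma : ∀ m z → m + 2 * suc z ≡ suc (m + suc (2 * z))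
  lemma = solve-∀

high-piece : ∀ {e} m r c → Σ[ x ∈ ℕ ] c + (x + r + (1 ∸ e)) ≡ m → Σ[ π ∈ Piece e m ] slack π ≡ r × dinvOf π ≡ suc (m + 2 * c)
high-piece {e} m r c (x , refl) = high c x r , refl , dinv-high {e} c x r

piece-of-slack-dinv : ∀ {e} → e ≤ 1 → ∀ m r i j → r + (i + j) ≡ 3 * m + e → r ≤ i → r ≤ j →
  Σ[ π ∈ Piece e m ] slack π ≡ r × dinvOf π ≡ i
piece-of-slack-dinv e≤1 m r i j sum r≤i r≤j with ≤-<-connex i m
... | inj₁ i≤m with m≤n⇒∃[o]m+o≡n r≤i | m≤n⇒∃[o]m+o≡n i≤m
...   | p , refl | u , eq = low-piece m r p u eq
piece-of-slack-dinv e≤1 m r i j sum r≤i r≤j | inj₂ m<i with m≤n⇒∃[o]m+o≡n m<i | m≤n⇒∃[o]m+o≡n r≤j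
... | d , refl | q , refl with even-or-odd d
...   | odd z  = mid-piece m r z (mid-shape e≤1 m r z q sum)
...   | even c = high-piece m r c (high-shape e≤1 m r c q sum)

onto : ∀ {e} → e ≤ 1 → ∀ m i j → Support (3 * m + e) i j → Σ[ π ∈ Piece e m ] dinvOf π ≡ i × areaOf π ≡ j
onto e≤1 m i j support with support⇒slack support
... | r , sum , r≤i , r≤j with piece-of-slack-dinv e≤1 m r i j sum r≤i r≤j
...   | π , refl , refl = π , refl , +-cancelˡ-≡ (dinvOf π) _ _ (+-cancelˡ-≡ (slack π) _ _ (trans (piece-slack e≤1 π) (sym sum)))

-- The coefficients of C_{3,n}

pathOf : Runs → List Step
pathOf (a , b , c) = path a b c

hasStatistics : ℕ → ℕ → ℕ → List Step → Bool
hasStatistics n i j w = isDyck n w ∧ ((dinv n w ≡ᵇ i) ∧ (area n w ≡ᵇ j))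

coeffC≡count : ∀ n i j → coeffC n i j ≡ countᵇ (hasStatistics n i j) (words (n + 3))
coeffC≡count n i j = countᵇ-filterᵇ (λ w → (dinv n w ≡ᵇ i) ∧ (area n w ≡ᵇ j)) (isDyck n) (words (n + 3))

module _ {m e : ℕ} (e≤1 : e ≤ 1) where

  private
    n = suc (3 * m + e)

  isDyck⇒piece : ∀ w → isDyck n w ≡ true → Σ[ π ∈ Piece e m ] w ≡ pathOf (runs π)
  isDyck⇒piece w dyck with isDyck⇒path n w dyck
  ... | triple a b c total col₁ col₂ , refl with cover e≤1 m a b c (total , column₁-threshold {m} e≤1 col₁ , column₂-threshold {m} e≤1 col₂)
  ...   | π , runs≡ = π , cong pathOf (sym runs≡)

  piece-isDyck : (π : Piece e m) → isDyck n (pathOf (runs π)) ≡ true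
  piece-isDyck π with piece-dyck e≤1 π
  ... | total , first-tall , second-tall =
    path-isDyck (triple (suc (m + area₁ π)) (run₂ π) (run₃ π) total (column₁-threshold⁻ {m} e≤1 first-tall) (column₂-threshold⁻ {m} e≤1 second-tall))

  piece-statistics : (π : Piece e m) → dinv n (pathOf (runs π)) ≡ dinvOf π × area n (pathOf (runs π)) ≡ areaOf π
  piece-statistics π with piece-dyck e≤1 π
  ... | total , first-tall , _ =
    trans (dinv-closed {m} e≤1 {suc (m + area₁ π)} total first-tall) (piece-dinv π) ,
    trans (area-closed {m} e≤1 {suc (m + area₁ π)} {run₂ π} {run₃ π} total) (piece-area e≤1 π)

  hasStatistics⇒piece : ∀ {i j} w → hasStatistics n i j w ≡ true → Σ[ π ∈ Piece e m ] w ≡ pathOf (runs π) × dinvOf π ≡ i × areaOf π ≡ j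
  hasStatistics⇒piece {i} {j} w has with ∧-true⁻ (isDyck n w) has
  ... | dyck , stats with isDyck⇒piece w dyck | ∧-true⁻ (dinv n w ≡ᵇ i) stats
  ...   | π , refl | dinv≡ , area≡ =
    π , refl , trans (sym (proj₁ (piece-statistics π))) (≡ᵇ-sound dinv≡) , trans (sym (proj₂ (piece-statistics π))) (≡ᵇ-sound area≡)

  coeffC-support : ∀ {i j} → Support (3 * m + e) i j → coeffC n i j ≡ 1
  coeffC-support {i} {j} support with onto e≤1 m i j support
  ... | π , dinv≡ , area≡ = begin
    coeffC n i j                                                 ≡⟨ coeffC≡count n i j ⟩
    countᵇ (hasStatistics n i j) (words (n + 3))                 ≡⟨ cong (countᵇ (hasStatistics n i j) ∘ words) (sym length≡) ⟩
    countᵇ (hasStatistics n i j) (words (length w₀))             ≡⟨ countᵇ-words-unique (hasStatistics n i j) w₀ has₀ unique ⟩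
    1                                                            ∎
    where
    open ≡-Reasoning
    w₀ = pathOf (runs π)
    length≡ : length w₀ ≡ n + 3
    length≡ = trans (length-path (suc (m + area₁ π)) (run₂ π) (run₃ π)) (cong (_+ 3) (proj₁ (piece-dyck e≤1 π)))
    has₀ : hasStatistics n i j w₀ ≡ true
    has₀ = ∧-true⁺ (piece-isDyck π) (∧-true⁺ (≡ᵇ-true (trans (proj₁ (piece-statistics π)) dinv≡)) (≡ᵇ-true (trans (proj₂ (piece-statistics π)) area≡)))
    unique : ∀ w → hasStatistics n i j w ≡ true → w ≡ w₀
    unique w has with hasStatistics⇒piece w has
    ... | π′ , refl , dinv′ , area′ = cong pathOf (piece-injective π′ π refl (trans dinv′ (sym dinv≡)) (trans area′ (sym area≡)))

  coeffC-no-support : ∀ {i j} → ¬ Support (3 * m + e) i j → coeffC n i j ≡ 0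
  coeffC-no-support {i} {j} ¬support = trans (coeffC≡count n i j) (countᵇ-none _ (words (n + 3)) never)
    where
    never : ∀ w → hasStatistics n i j w ≡ false
    never w with hasStatistics n i j w in has
    ... | false = refl
    ... | true with hasStatistics⇒piece w has
    ...   | π , _ , refl , refl = ⊥-elim (¬support (piece-support e≤1 π))

not-multiple-of-3 : ∀ n → ¬ 3 ∣ n → Σ[ m ∈ ℕ ] Σ[ e ∈ ℕ ] e ≤ 1 × n ≡ suc (3 * m + e)
not-multiple-of-3 n 3∤n with n % 3 | m≡m%n+[m/n]*n n 3 | m%n<n n 3 | m%n≡0⇒n∣m n 3
... | zero  | _  | _               | 3∣n = ⊥-elim (3∤n (3∣n refl))
... | suc e | eq | s≤s (s≤s e≤1) | _   = n / 3 , e , e≤1 , trans eq (lemma e (n / 3))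
  where
  lemma : ∀ e q → suc e + q * 3 ≡ suc (3 * q + e)
  lemma = solve-∀

-- The hypothesis 1 ≤ n is implied by ¬ 3 ∣ n.
mainTheorem3 : (n : ℕ) → 1 ≤ n → ¬ (3 ∣ n) →
    (i j : ℕ) → coeffC n i j ≡ coeffC n j i
mainTheorem3 n _ 3∤n i j with not-multiple-of-3 n 3∤n
... | m , e , e≤1 , refl with support? (3 * m + e) i j
...   | yes support = trans (coeffC-support {m} e≤1 support) (sym (coeffC-support {m} e≤1 (support-sym {3 * m + e} {i} {j} support)))
...   | no ¬support = trans (coeffC-no-support {m} e≤1 ¬support) (sym (coeffC-no-support {m} e≤1 (¬support ∘ support-sym {3 * m + e} {j} {i})))
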